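{- Let integers $a,x,u,v$ satisfy $3\le a\le x$, $0\le u\le a-3$, and $u+2\le v\le\min(a-1,\,a(x-1)/x)$. Let $\lambda$ consist of $ua+v$ parts equal to $x$ and $v-(u+1)$ parts equal to $ax$, let $n=|\lambda|$ (so $n-1=xa(v-1)+xv-1$), and suppose $n-1$ is coprime to both $x$ and $a$. For $0\le i\le n-2$ write $i=\frac{n}{x}r_i+(v-1)p_i+q_i$ with $0\le r_i<x$, $0\le p_i<a+2$, $0\le q_i<v-1$, $0\le(v-1)p_i+q_i<n/x$, and $q_i=0$ whenever $p_i=a+1$. Let $f(i)=ar_i-(xv-1)p_i+xaq_i$ and $F_k=\{i\in\{1,\dots,n-2\}: k=-\lfloor f(i)/(n-1)\rfloor\}$. Let $k,\ell\in\mathbb{Z}$, $i\in F_k$ and $j\in F_{k+\ell}$ with $i\ne j$. Then $i\preceq j$ in $P(\lambda)$ if and only if the vector $y=(p_j-p_i,\,q_j-q_i,\,r_j-r_i)^T$ satisfies the strict componentwise inequality $Cy>(\ell(n-1),0,0)^T$, where \[C=\begin{bmatrix} xv-1 & -ax & -a\\ 1-v & -1 & 0\\ 0 & 0 & 1\end{bmatrix}.\]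
   Context: For $\lambda=(\lambda_1,\dots,\lambda_d)$ positive integers summing to $n$, $\Delta_\lambda=\mathrm{conv}(e_1,\dots,e_d,\lambda)\subset\mathbb{R}^d$ ($e_i$ standard basis vectors), with fundamental parallelepiped $\Pi_\lambda=\{\sum_{i=1}^d\gamma_i(1,e_i)+\gamma_{d+1}(1,\lambda): 0\le\gamma_i<1\}$. The poset $P(\lambda)$ is $\Pi_\lambda\cap\mathbb{Z}^{d+1}$ with $\sigma\preceq\mu$ iff $\mu-\sigma\in\Pi_\lambda\cap\mathbb{Z}^{d+1}$; its elements are identified with $b\in\{0,\dots,n-2\}$ via the bijection $b\mapsto p(b)=\big((\sum_{t}\lceil b\lambda_t/(n-1)\rceil)-b,\lceil b\lambda_1/(n-1)\rceil,\dots,\lceil b\lambda_d/(n-1)\rceil\big)$. The integers $r_i,p_i,q_i$ are uniquely determined by $i$. -}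

module Defs where

open import Data.Nat as ℕ using (ℕ; zero; suc; _<ᵇ_)
open import Data.Integer as ℤ using (ℤ; +_)
open import Data.Rational as ℚ using (ℚ; 0ℚ; 1ℚ; floor; ceiling)
open import Data.Fin using (Fin; zero; suc; toℕ)
open import Data.Product using (Σ; _×_)
open import Data.Bool using (if_then_else_)
open import Relation.Binary.PropositionalEquality using (_≡_)
open import Function using (_∘_)

-- integer / natural as a rational (0 when the denominator is 0; never used so here)
_÷_ : ℤ → ℕ → ℚ
z ÷ zero = 0ℚ
z ÷ suc m = z ℚ./ suc m

_/'_ : ℕ → ℕ → ℕ
m /' zero = 0
m /' suc k = m ℕ./ suc k

toℚ : ℤ → ℚ
toℚ z = z ℚ./ 1

sumℕ : ∀ {d} → (Fin d → ℕ) → ℕ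
sumℕ {zero} f = 0
sumℕ {suc d} f = f zero ℕ.+ sumℕ (f ∘ suc)

sumℤ : ∀ {d} → (Fin d → ℤ) → ℤ
sumℤ {zero} f = + 0
sumℤ {suc d} f = f zero ℤ.+ sumℤ (f ∘ suc)

sumℚ : ∀ {d} → (Fin d → ℚ) → ℚ
sumℚ {zero} f = 0ℚ
sumℚ {suc d} f = f zero ℚ.+ sumℚ (f ∘ suc)

-- General λ = (λ_1,…,λ_d), n = |λ|.  Coordinates of ℝ^{d+1}: index
-- zero is the first coordinate, index (suc t) is coordinate t+1.

cb : ∀ {d} → (Fin d → ℕ) → ℕ → Fin d → ℤ
cb lam b t = ceiling ((+ (b ℕ.* lam t)) ÷ (sumℕ lam ℕ.∸ 1))

pt : ∀ {d} → (Fin d → ℕ) → ℕ → Fin (suc d) → ℤ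
pt lam b zero = sumℤ (cb lam b) ℤ.- (+ b)
pt lam b (suc t) = cb lam b t

-- w ∈ Π_λ : w = Σ_t γ_t (1,e_t) + γ_{d+1} (1,λ) with all 0 ≤ γ < 1.
-- (The generators are linearly independent, so the γ's are unique and
-- rational; quantifying over ℚ is therefore exact.)
InΠ : ∀ {d} → (Fin d → ℕ) → (Fin (suc d) → ℤ) → Set
InΠ {d} lam w =
  Σ (Fin d → ℚ) λ γ → Σ ℚ λ g →
    (∀ t → (0ℚ ℚ.≤ γ t) × (γ t ℚ.< 1ℚ)) ×
    ((0ℚ ℚ.≤ g) × (g ℚ.< 1ℚ)) ×
    (toℚ (w zero) ≡ sumℚ γ ℚ.+ g) ×
    (∀ t → toℚ (w (suc t)) ≡ γ t ℚ.+ g ℚ.* toℚ (+ lam t))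

-- σ ⪯ μ in P(λ), elements identified with b ∈ {0,…,n-2} via p
_⪯[_]_ : ℕ → ∀ {d} → (Fin d → ℕ) → ℕ → Set
b ⪯[ lam ] b' = InΠ lam (λ s → pt lam b' s ℤ.- pt lam b s)

dim : ℕ → ℕ → ℕ → ℕ
dim a u v = (u ℕ.* a ℕ.+ v) ℕ.+ (v ℕ.∸ (u ℕ.+ 1))

lamT : (a x u v : ℕ) → Fin (dim a u v) → ℕ
lamT a x u v t = if toℕ t <ᵇ (u ℕ.* a ℕ.+ v) then x else a ℕ.* x

Decomp : (a x v n i r p q : ℕ) → Set
Decomp a x v n i r p q =
  (i ≡ (n /' x) ℕ.* r ℕ.+ (v ℕ.∸ 1) ℕ.* p ℕ.+ q) ×
  (r ℕ.< x) × (p ℕ.< a ℕ.+ 2) × (q ℕ.< v ℕ.∸ 1) ×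
  ((v ℕ.∸ 1) ℕ.* p ℕ.+ q ℕ.< n /' x) ×
  (p ≡ a ℕ.+ 1 → q ≡ 0)

fval : (a x v r p q : ℕ) → ℤ
fval a x v r p q =
  (+ a) ℤ.* (+ r) ℤ.- ((+ (x ℕ.* v)) ℤ.- + 1) ℤ.* (+ p) ℤ.+ (+ x) ℤ.* (+ a) ℤ.* (+ q)

InF : (n : ℕ) (k : ℤ) (i : ℕ) (fi : ℤ) → Set
InF n k i fi = (1 ℕ.≤ i) × (i ℕ.≤ n ℕ.∸ 2) × (k ≡ ℤ.- floor (fi ÷ (n ℕ.∸ 1)))

Cmat : (a x v : ℕ) → Fin 3 → Fin 3 → ℤ
Cmat a x v zero zero = (+ (x ℕ.* v)) ℤ.- + 1
Cmat a x v zero (suc zero) = ℤ.- (+ (a ℕ.* x))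
Cmat a x v zero (suc (suc zero)) = ℤ.- (+ a)
Cmat a x v (suc zero) zero = + 1 ℤ.- + v
Cmat a x v (suc zero) (suc zero) = ℤ.- + 1
Cmat a x v (suc zero) (suc (suc zero)) = + 0
Cmat a x v (suc (suc zero)) zero = + 0
Cmat a x v (suc (suc zero)) (suc zero) = + 0
Cmat a x v (suc (suc zero)) (suc (suc zero)) = + 1

_·_ : ∀ {m k} → (Fin m → Fin k → ℤ) → (Fin k → ℤ) → Fin m → ℤ
(M · y) s = sumℤ (λ t → M s t ℤ.* y t)

_>ᶜ_ : ∀ {m} → (Fin m → ℤ) → (Fin m → ℤ) → Set
w >ᶜ z = ∀ s → z s ℤ.< w s

vec3 : ℤ → ℤ → ℤ → Fin 3 → ℤ
vec3 a b c zero = a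
vec3 a b c (suc zero) = b
vec3 a b c (suc (suc zero)) = c

-- Write N = n − 1. Solving p(j) − p(i) = Σₜ γₜ (1,eₜ) + g (1,λ) gives N g = j − i and
-- N γₜ = Gₜ(j) − Gₜ(i), where Gₜ(b) = N⌈bλₜ/N⌉ − bλₜ lies in [0,N). Hence i ⪯ j iff
-- 0 ≤ j − i < N and no Gₜ decreases from i to j, and only the parts x and a x matter.
-- For b = (n/x) r + s with s = (v−1) p + q one has b x = N r + (r + s x), so
-- G_x(b) = N − (r + s x); and b a x ≡ f(b) (mod N), so G_ax(b) = N − ρ(b) with ρ(b) the
-- residue of f(b), which is nonzero, and differs for i ≠ j, since N is coprime to a and x.
-- In these digits, i < j with r + s x not increasing means rᵢ < rⱼ and sⱼ < sᵢ, while the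
-- rows of C y are ρᵢ − ρⱼ + ℓ N (by the choice of k), sᵢ − sⱼ and rⱼ − rᵢ.

module Submission where

open import Defs
open import Data.Nat using (ℕ; _+_; _*_; _∸_; _≤_)
open import Data.Integer using (ℤ; +_; _-_) renaming (_+_ to _+ℤ_; _*_ to _*ℤ_)
open import Data.Nat.Coprimality using (Coprime)
open import Relation.Binary.PropositionalEquality using (_≢_)
open import Function.Bundles using (_⇔_)

open import Data.Bool.Base as Bool using (true; false; if_then_else_)
open import Data.Empty using (⊥-elim)
open import Data.Fin.Base using (Fin; zero; suc; toℕ; fromℕ<)
open import Data.Fin.Properties using (toℕ-fromℕ<)
open import Data.Integer.Base as ℤ using (-[1+_])
import Data.Integer.DivMod as ℤ
import Data.Integer.Properties as ℤ
open import Data.Integer.Tactic.RingSolver using (solve-∀)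
open import Data.Nat.Base as ℕ using (zero; suc; _<_; _<ᵇ_; s≤s; z≤n)
import Data.Nat.Coprimality as Coprimality
open import Data.Nat.Divisibility using (_∣_; divides)
import Data.Nat.Divisibility as ℕ
import Data.Nat.DivMod as ℕ
import Data.Nat.Properties as ℕ
open import Data.Nat.Tactic.RingSolver using () renaming (solve-∀ to solve-∀ℕ)
open import Data.Product.Base using (Σ; _×_; _,_; proj₁; proj₂)
open import Data.Product.Function.NonDependent.Propositional using (_×-⇔_)
open import Data.Rational.Base as ℚ using (ℚ; 0ℚ; 1ℚ; mkℚ; ↥_; ↧_; floor; ceiling)
import Data.Rational.Properties as ℚ
open import Data.Rational.Solver using (module +-*-Solver)
import Data.Rational.Unnormalised.Base as ℚᵘ
import Data.Rational.Unnormalised.Properties as ℚᵘ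
open import Data.Sum.Base using (_⊎_; inj₁; inj₂; [_,_]′)
open import Data.Unit.Base using (tt)
open import Function.Base using (_∘_)
open import Function.Bundles using (mk⇔; Equivalence)
import Function.Properties.Equivalence as Fn
open import Relation.Binary.Definitions using (tri<; tri≈; tri>)
open import Relation.Binary.PropositionalEquality
open import Relation.Nullary.Decidable.Core using (yes; no)
open import Relation.Nullary.Negation.Core using (¬_)

-- Integers inside the rationals

coprime-1 : ∀ n → Coprime n 1
coprime-1 n = Coprimality.sym (Coprimality.1-coprimeTo n)

toℚ≡mkℚ : ∀ z → toℚ z ≡ mkℚ z 0 (coprime-1 ℤ.∣ z ∣)
toℚ≡mkℚ (+ n) = ℚ.normalize-coprime (coprime-1 n)
toℚ≡mkℚ -[1+ n ] = cong ℚ.-_ (ℚ.normalize-coprime (coprime-1 (suc n)))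

toℚ-homo-+ : ∀ a b → toℚ (a +ℤ b) ≡ toℚ a ℚ.+ toℚ b
toℚ-homo-+ a b rewrite toℚ≡mkℚ a | toℚ≡mkℚ b = cong (ℚ._/ 1) (identity a b)
  where
  identity : ∀ a b → a +ℤ b ≡ a *ℤ + 1 +ℤ b *ℤ + 1
  identity = solve-∀

toℚ-homo-* : ∀ a b → toℚ (a *ℤ b) ≡ toℚ a ℚ.* toℚ b
toℚ-homo-* a b rewrite toℚ≡mkℚ a | toℚ≡mkℚ b = refl

toℚ-homo-neg : ∀ a → toℚ (ℤ.- a) ≡ ℚ.- toℚ a
toℚ-homo-neg (+ zero) = refl
toℚ-homo-neg (+ suc n) = refl
toℚ-homo-neg -[1+ n ] rewrite toℚ≡mkℚ -[1+ n ] = toℚ≡mkℚ (+ suc n)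

toℚ-homo-sub : ∀ a b → toℚ (a - b) ≡ toℚ a ℚ.- toℚ b
toℚ-homo-sub a b = trans (toℚ-homo-+ a (ℤ.- b)) (cong (toℚ a ℚ.+_) (toℚ-homo-neg b))

toℚ-mono-≤ : ∀ {a b} → a ℤ.≤ b → toℚ a ℚ.≤ toℚ b
toℚ-mono-≤ {a} {b} a≤b rewrite toℚ≡mkℚ a | toℚ≡mkℚ b =
  ℚ.*≤* (subst₂ ℤ._≤_ (sym (ℤ.*-identityʳ a)) (sym (ℤ.*-identityʳ b)) a≤b)

toℚ-cancel-≤ : ∀ {a b} → toℚ a ℚ.≤ toℚ b → a ℤ.≤ b
toℚ-cancel-≤ {a} {b} a≤b rewrite toℚ≡mkℚ a | toℚ≡mkℚ b with a≤b
... | ℚ.*≤* a*1≤b*1 = subst₂ ℤ._≤_ (ℤ.*-identityʳ a) (ℤ.*-identityʳ b) a*1≤b*1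

toℚ-mono-< : ∀ {a b} → a ℤ.< b → toℚ a ℚ.< toℚ b
toℚ-mono-< {a} {b} a<b rewrite toℚ≡mkℚ a | toℚ≡mkℚ b =
  ℚ.*<* (subst₂ ℤ._<_ (sym (ℤ.*-identityʳ a)) (sym (ℤ.*-identityʳ b)) a<b)

toℚ-cancel-< : ∀ {a b} → toℚ a ℚ.< toℚ b → a ℤ.< b
toℚ-cancel-< {a} {b} a<b rewrite toℚ≡mkℚ a | toℚ≡mkℚ b with a<b
... | ℚ.*<* a*1<b*1 = subst₂ ℤ._<_ (ℤ.*-identityʳ a) (ℤ.*-identityʳ b) a*1<b*1

↥/-cross : ∀ z m → ↥ (z ℚ./ suc m) *ℤ + suc m ≡ z *ℤ ↧ (z ℚ./ suc m)
↥/-cross z m with z ℚ./ suc m | ℚ.toℚᵘ-fromℚᵘ (ℚᵘ.mkℚᵘ z m)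
... | mkℚ _ _ _ | ℚᵘ.*≡* eq = eq

cross⇒/≡/ : ∀ a b c d → a *ℤ + suc d ≡ b *ℤ + suc c → a ℚ./ suc c ≡ b ℚ./ suc d
cross⇒/≡/ a b c d eq = ℚ.toℚᵘ-injective (ℚᵘ.≃-trans (ℚ.toℚᵘ-fromℚᵘ (ℚᵘ.mkℚᵘ a c))
  (ℚᵘ.≃-trans (ℚᵘ.*≡* eq) (ℚᵘ.≃-sym (ℚ.toℚᵘ-fromℚᵘ (ℚᵘ.mkℚᵘ b d)))))

÷-*-cancel : ∀ z m → (z ÷ suc m) ℚ.* toℚ (+ suc m) ≡ toℚ z
÷-*-cancel z m rewrite toℚ≡mkℚ (+ suc m) with z ℚ./ suc m | ↥/-cross z m
... | mkℚ n d _ | cross = cross⇒/≡/ (n *ℤ + suc m) z (d * 1) 0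
  (trans (ℤ.*-identityʳ _) (trans cross (cong (λ e → z *ℤ + e) (sym (ℕ.*-identityʳ (suc d))))))

sumℚ-cong : ∀ {d} {f g : Fin d → ℚ} → (∀ t → f t ≡ g t) → sumℚ f ≡ sumℚ g
sumℚ-cong {zero} f≗g = refl
sumℚ-cong {suc d} f≗g = cong₂ ℚ._+_ (f≗g zero) (sumℚ-cong (f≗g ∘ suc))

toℚ-sumℤ : ∀ {d} (f : Fin d → ℤ) → toℚ (sumℤ f) ≡ sumℚ (toℚ ∘ f)
toℚ-sumℤ {zero} f = refl
toℚ-sumℤ {suc d} f = trans (toℚ-homo-+ (f zero) _) (cong (toℚ (f zero) ℚ.+_) (toℚ-sumℤ (f ∘ suc)))

sumℤ-pos : ∀ {d} (f : Fin d → ℕ) → sumℤ (+_ ∘ f) ≡ + sumℕ f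
sumℤ-pos {zero} f = refl
sumℤ-pos {suc d} f = cong (+ f zero +ℤ_) (sumℤ-pos (f ∘ suc))

sumℤ-sub : ∀ {d} (f g : Fin d → ℤ) → sumℤ (λ t → f t - g t) ≡ sumℤ f - sumℤ g
sumℤ-sub {zero} f g = refl
sumℤ-sub {suc d} f g = trans (cong ((f zero - g zero) +ℤ_) (sumℤ-sub (f ∘ suc) (g ∘ suc)))
  (interchange (f zero) (g zero) (sumℤ (f ∘ suc)) (sumℤ (g ∘ suc)))
  where
  interchange : ∀ a b c e → (a - b) +ℤ (c - e) ≡ (a +ℤ c) - (b +ℤ e)
  interchange = solve-∀

sumℚ-+-* : ∀ {d} (γ l : Fin d → ℚ) g → sumℚ (λ t → γ t ℚ.+ g ℚ.* l t) ≡ sumℚ γ ℚ.+ g ℚ.* sumℚ l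
sumℚ-+-* {zero} γ l g = solve 1 (λ g → con 0ℚ := con 0ℚ :+ g :* con 0ℚ) refl g
  where open +-*-Solver
sumℚ-+-* {suc d} γ l g = trans (cong ((γ zero ℚ.+ g ℚ.* l zero) ℚ.+_) (sumℚ-+-* (γ ∘ suc) (l ∘ suc) g))
  (solve 5 (λ a b g c e → (a :+ g :* b) :+ (c :+ g :* e) := (a :+ c) :+ g :* (b :+ e)) refl
     (γ zero) (l zero) g (sumℚ (γ ∘ suc)) (sumℚ (l ∘ suc)))
  where open +-*-Solver

-- Residues modulo N

infix 4 0≤_<_

0≤_<_ : ℤ → ℤ → Set
0≤ z < N = (+ 0 ℤ.≤ z) × (z ℤ.< N)

0<-⇔< : ∀ A B → + 0 ℤ.< B - A ⇔ A ℤ.< B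
0<-⇔< A B = mk⇔
  (λ 0<B-A → subst₂ ℤ._<_ (ℤ.+-identityˡ A) (cancel A B) (ℤ.+-monoˡ-< A 0<B-A))
  (λ A<B → subst (ℤ._< B - A) (ℤ.+-inverseʳ A) (ℤ.+-monoˡ-< (ℤ.- A) A<B))
  where
  cancel : ∀ A B → (B - A) +ℤ A ≡ B
  cancel = solve-∀

<+⇔0< : ∀ C D → C ℤ.< D +ℤ C ⇔ + 0 ℤ.< D
<+⇔0< C D = subst (λ E → C ℤ.< D +ℤ C ⇔ + 0 ℤ.< E) (cancel C D) (Fn.sym (0<-⇔< C (D +ℤ C)))
  where
  cancel : ∀ C D → (D +ℤ C) - C ≡ D
  cancel = solve-∀

-≤-⇔≥ : ∀ N A B → N - A ℤ.≤ N - B ⇔ B ℤ.≤ A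
-≤-⇔≥ N A B = mk⇔
  (λ le → ℤ.0≤i-j⇒j≤i (subst (+ 0 ℤ.≤_) (cancel N A B) (ℤ.i≤j⇒0≤j-i le)))
  (λ B≤A → ℤ.+-monoʳ-≤ N (ℤ.neg-mono-≤ B≤A))
  where
  cancel : ∀ N A B → (N - B) - (N - A) ≡ A - B
  cancel = solve-∀

residue-≤⇔ : ∀ {N A B} → 0≤ A < N → 0≤ B < N → 0≤ B - A < N ⇔ A ℤ.≤ B
residue-≤⇔ {N} {A} {B} (0≤A , _) (_ , B<N) = mk⇔ (ℤ.0≤i-j⇒j≤i ∘ proj₁)
  (λ A≤B → ℤ.i≤j⇒0≤j-i A≤B ,
    ℤ.≤-<-trans (ℤ.≤-trans (ℤ.+-monoʳ-≤ B (ℤ.neg-mono-≤ 0≤A)) (ℤ.≤-reflexive (ℤ.+-identityʳ B))) B<N)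

N≤B+N*suc : ∀ m {B} K → + 0 ℤ.≤ B → + suc m ℤ.≤ B +ℤ + suc m *ℤ + suc K
N≤B+N*suc m {B} K 0≤B = begin
  + suc m                        ≡⟨ ℤ.+-identityˡ (+ suc m) ⟨
  + 0 +ℤ + suc m                 ≤⟨ ℤ.+-mono-≤ 0≤B (ℤ.+≤+ (ℕ.m≤m*n (suc m) (suc K))) ⟩
  B +ℤ + (suc m * suc K)         ≡⟨ cong (B +ℤ_) (ℤ.pos-* (suc m) (suc K)) ⟩
  B +ℤ + suc m *ℤ + suc K        ∎
  where open ℤ.≤-Reasoning

residue-unique : ∀ {m A B} k → 0≤ A < + suc m → 0≤ B < + suc m → A ≡ B +ℤ + suc m *ℤ k → A ≡ B
residue-unique {m} {A} {B} (+ zero) _ _ A≡ = trans A≡ (trans (cong (B +ℤ_) (ℤ.*-zeroʳ (+ suc m))) (ℤ.+-identityʳ B))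
residue-unique {m} (+ suc K) (_ , A<N) (0≤B , _) refl = ⊥-elim (ℤ.<⇒≱ A<N (N≤B+N*suc m K 0≤B))
residue-unique {m} {A} {B} -[1+ K ] (0≤A , _) (_ , B<N) A≡ =
  ⊥-elim (ℤ.<⇒≱ B<N (subst (+ suc m ℤ.≤_) (sym B≡) (N≤B+N*suc m K 0≤A)))
  where
  B≡ : B ≡ A +ℤ + suc m *ℤ + suc K
  B≡ = trans (shift B (+ suc m) (+ suc K)) (cong (_+ℤ + suc m *ℤ + suc K) (sym A≡))
    where
    shift : ∀ B N K → B ≡ (B +ℤ N *ℤ ℤ.- K) +ℤ N *ℤ K
    shift = solve-∀

floor-*-bounds : ∀ q z m → ↥ q *ℤ + suc m ≡ z *ℤ ↧ q →
  floor q *ℤ + suc m ℤ.≤ z × z ℤ.< (floor q +ℤ + 1) *ℤ + suc m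
floor-*-bounds q@(mkℚ n d _) z m cross = ℤ.*-cancelʳ-≤-pos (F *ℤ N) z D lower , ℤ.*-cancelʳ-<-nonNeg D upper
  where
  open ℤ.≤-Reasoning
  N D F : ℤ
  N = + suc m
  D = + suc d
  F = n ℤ./ D
  n≡r+FD : n ≡ + (n ℤ.% D) +ℤ F *ℤ D
  n≡r+FD = ℤ.a≡a%n+[a/n]*n n D
  FD≤n : F *ℤ D ℤ.≤ n
  FD≤n = subst (F *ℤ D ℤ.≤_) (trans (ℤ.+-comm (F *ℤ D) _) (sym n≡r+FD)) (ℤ.i≤i+j (F *ℤ D) (+ (n ℤ.% D)))
  lower : (F *ℤ N) *ℤ D ℤ.≤ z *ℤ D
  lower = begin
    (F *ℤ N) *ℤ D           ≡⟨ swap F N D ⟩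
    (F *ℤ D) *ℤ N           ≤⟨ ℤ.*-monoʳ-≤-nonNeg N FD≤n ⟩
    n *ℤ N                  ≡⟨ cross ⟩
    z *ℤ D                  ∎
    where
    swap : ∀ F N D → (F *ℤ N) *ℤ D ≡ (F *ℤ D) *ℤ N
    swap = solve-∀
  upper : z *ℤ D ℤ.< ((F +ℤ + 1) *ℤ N) *ℤ D
  upper = begin-strict
    z *ℤ D                       ≡⟨ cross ⟨
    n *ℤ N                       <⟨ ℤ.*-monoʳ-<-pos N (begin-strict
                                      n                        ≡⟨ n≡r+FD ⟩
                                      + (n ℤ.% D) +ℤ F *ℤ D    <⟨ ℤ.+-monoˡ-< (F *ℤ D) (ℤ.+<+ (ℤ.n%d<d n D)) ⟩
                                      D +ℤ F *ℤ D              ∎) ⟩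
    (D +ℤ F *ℤ D) *ℤ N           ≡⟨ factor F N D ⟩
    ((F +ℤ + 1) *ℤ N) *ℤ D       ∎
    where
    factor : ∀ F N D → (D +ℤ F *ℤ D) *ℤ N ≡ ((F +ℤ + 1) *ℤ N) *ℤ D
    factor = solve-∀

bounds⇒remainder : ∀ F N z → F *ℤ N ℤ.≤ z → z ℤ.< (F +ℤ + 1) *ℤ N → 0≤ z - F *ℤ N < N
bounds⇒remainder F N z FN≤z z<F+1N =
  ℤ.i≤j⇒0≤j-i FN≤z ,
  ℤ.<-≤-trans (ℤ.+-monoˡ-< (ℤ.- (F *ℤ N)) z<F+1N) (ℤ.≤-reflexive (cancel F N))
  where
  cancel : ∀ F N → (F +ℤ + 1) *ℤ N - F *ℤ N ≡ N
  cancel = solve-∀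

floor-remainder : ∀ z m → 0≤ z - floor (z ÷ suc m) *ℤ + suc m < + suc m
floor-remainder z m = bounds⇒remainder (floor (z ÷ suc m)) (+ suc m) z (proj₁ bounds) (proj₂ bounds)
  where bounds = floor-*-bounds (z ÷ suc m) z m (↥/-cross z m)

ceiling≡-floor-neg : ∀ q → ceiling q ≡ ℤ.- floor (ℚ.- q)
ceiling≡-floor-neg (mkℚ _ _ _) = refl

ceiling-remainder : ∀ z m → 0≤ ceiling (z ÷ suc m) *ℤ + suc m - z < + suc m
ceiling-remainder z m = subst (0≤_< + suc m)
  (trans (rearrange (floor (ℚ.- q)) (+ suc m) z) (cong (λ c → c *ℤ + suc m - z) (sym (ceiling≡-floor-neg q))))
  (bounds⇒remainder (floor (ℚ.- q)) (+ suc m) (ℤ.- z) (proj₁ bounds) (proj₂ bounds))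
  where
  q = z ÷ suc m
  open ≡-Reasoning
  cross : ↥ (ℚ.- q) *ℤ + suc m ≡ (ℤ.- z) *ℤ ↧ (ℚ.- q)
  cross = begin
    ↥ (ℚ.- q) *ℤ + suc m      ≡⟨ cong (_*ℤ + suc m) (ℚ.↥-neg q) ⟩
    ℤ.- ↥ q *ℤ + suc m        ≡⟨ ℤ.neg-distribˡ-* (↥ q) (+ suc m) ⟨
    ℤ.- (↥ q *ℤ + suc m)      ≡⟨ cong ℤ.-_ (↥/-cross z m) ⟩
    ℤ.- (z *ℤ ↧ q)            ≡⟨ ℤ.neg-distribˡ-* z (↧ q) ⟩
    (ℤ.- z) *ℤ ↧ q            ≡⟨ cong ((ℤ.- z) *ℤ_) (ℚ.↧-neg q) ⟨
    (ℤ.- z) *ℤ ↧ (ℚ.- q)      ∎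
  bounds = floor-*-bounds (ℚ.- q) (ℤ.- z) m cross
  rearrange : ∀ F N z → ℤ.- z - F *ℤ N ≡ (ℤ.- F) *ℤ N - z
  rearrange = solve-∀

-- The order on P(λ)

∸1≡suc⇒≡suc+1 : ∀ {n k} → n ∸ 1 ≡ suc k → n ≡ suc k + 1
∸1≡suc⇒≡suc+1 {suc n} refl = ℕ.+-comm 1 n

module Parallelepiped {d} (lam : Fin d → ℕ) (m : ℕ) (n∸1≡1+m : sumℕ lam ∸ 1 ≡ suc m) where

  N : ℤ
  N = + suc m

  -- If w = Σₜ γₜ (1,eₜ) + g (1,λ), then these are N g and N γₜ (as Σₜ λₜ = N + 1).
  scaledLast : (Fin (suc d) → ℤ) → ℤ
  scaledLast w = sumℤ (w ∘ suc) - w zero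

  scaledCoord : (Fin (suc d) → ℤ) → Fin d → ℤ
  scaledCoord w t = N *ℤ w (suc t) - scaledLast w *ℤ + lam t

  private
    Nℚ : ℚ
    Nℚ = mkℚ N 0 (coprime-1 (suc m))

    toℚN : toℚ N ≡ Nℚ
    toℚN = toℚ≡mkℚ N

    sum-lam : sumℚ (λ t → toℚ (+ lam t)) ≡ Nℚ ℚ.+ 1ℚ
    sum-lam = begin
      sumℚ (λ t → toℚ (+ lam t)) ≡⟨ toℚ-sumℤ (+_ ∘ lam) ⟨
      toℚ (sumℤ (+_ ∘ lam))       ≡⟨ cong toℚ (trans (sumℤ-pos lam) (cong +_ (∸1≡suc⇒≡suc+1 n∸1≡1+m))) ⟩
      toℚ (N +ℤ + 1)              ≡⟨ trans (toℚ-homo-+ N (+ 1)) (cong (ℚ._+ 1ℚ) toℚN) ⟩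
      Nℚ ℚ.+ 1ℚ                   ∎
      where open ≡-Reasoning

  scaledLast-≡ : ∀ w (γ : Fin d → ℚ) g → toℚ (w zero) ≡ sumℚ γ ℚ.+ g →
    (∀ t → toℚ (w (suc t)) ≡ γ t ℚ.+ g ℚ.* toℚ (+ lam t)) → toℚ (scaledLast w) ≡ g ℚ.* Nℚ
  scaledLast-≡ w γ g w₀≡ wₜ≡ = begin
    toℚ (scaledLast w)                                       ≡⟨ toℚ-homo-sub (sumℤ (w ∘ suc)) (w zero) ⟩
    toℚ (sumℤ (w ∘ suc)) ℚ.- toℚ (w zero)                      ≡⟨ cong₂ ℚ._-_ sum-w w₀≡ ⟩
    (sumℚ γ ℚ.+ g ℚ.* (Nℚ ℚ.+ 1ℚ)) ℚ.- (sumℚ γ ℚ.+ g)          ≡⟨ cancel (sumℚ γ) g Nℚ ⟩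
    g ℚ.* Nℚ                                                  ∎
    where
    open ≡-Reasoning
    open +-*-Solver
    sum-w : toℚ (sumℤ (w ∘ suc)) ≡ sumℚ γ ℚ.+ g ℚ.* (Nℚ ℚ.+ 1ℚ)
    sum-w = trans (toℚ-sumℤ (w ∘ suc)) (trans (sumℚ-cong wₜ≡)
      (trans (sumℚ-+-* γ _ g) (cong (λ s → sumℚ γ ℚ.+ g ℚ.* s) sum-lam)))
    cancel : ∀ a g n → (a ℚ.+ g ℚ.* (n ℚ.+ 1ℚ)) ℚ.- (a ℚ.+ g) ≡ g ℚ.* n
    cancel = solve 3 (λ a g n → (a :+ g :* (n :+ con 1ℚ)) :- (a :+ g) := g :* n) refl

  scaledCoord-≡ : ∀ w (γ : Fin d → ℚ) g → toℚ (scaledLast w) ≡ g ℚ.* Nℚ → ∀ t →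
    toℚ (w (suc t)) ≡ γ t ℚ.+ g ℚ.* toℚ (+ lam t) → toℚ (scaledCoord w t) ≡ γ t ℚ.* Nℚ
  scaledCoord-≡ w γ g last≡ t wₜ≡ = begin
    toℚ (scaledCoord w t)                                            ≡⟨ toℚ-homo-sub (N *ℤ w (suc t)) (scaledLast w *ℤ + lam t) ⟩
    toℚ (N *ℤ w (suc t)) ℚ.- toℚ (scaledLast w *ℤ + lam t)             ≡⟨ cong₂ ℚ._-_ (toℚ-homo-* N (w (suc t))) (toℚ-homo-* (scaledLast w) (+ lam t)) ⟩
    toℚ N ℚ.* toℚ (w (suc t)) ℚ.- toℚ (scaledLast w) ℚ.* toℚ (+ lam t) ≡⟨ cong₃ toℚN wₜ≡ last≡ ⟩
    Nℚ ℚ.* (γ t ℚ.+ g ℚ.* l) ℚ.- (g ℚ.* Nℚ) ℚ.* l                     ≡⟨ cancel Nℚ (γ t) g l ⟩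
    γ t ℚ.* Nℚ                                                        ∎
    where
    open ≡-Reasoning
    open +-*-Solver
    l = toℚ (+ lam t)
    cong₃ : ∀ {a a' b b' c c'} → a ≡ a' → b ≡ b' → c ≡ c' → a ℚ.* b ℚ.- c ℚ.* l ≡ a' ℚ.* b' ℚ.- c' ℚ.* l
    cong₃ refl refl refl = refl
    cancel : ∀ n c g l → n ℚ.* (c ℚ.+ g ℚ.* l) ℚ.- (g ℚ.* n) ℚ.* l ≡ c ℚ.* n
    cancel = solve 4 (λ n c g l → n :* (c :+ g :* l) :- (g :* n) :* l := c :* n) refl

  scaled-range⇔ : ∀ z q → toℚ z ≡ q ℚ.* Nℚ → ((0ℚ ℚ.≤ q) × (q ℚ.< 1ℚ)) ⇔ 0≤ z < N
  scaled-range⇔ z q z≡qN = mk⇔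
    (λ (0≤q , q<1) →
      toℚ-cancel-≤ (subst₂ ℚ._≤_ (ℚ.*-zeroˡ Nℚ) (sym z≡qN) (ℚ.*-monoʳ-≤-nonNeg Nℚ 0≤q)) ,
      toℚ-cancel-< (subst₂ ℚ._<_ (sym z≡qN) (trans (ℚ.*-identityˡ Nℚ) (sym toℚN)) (ℚ.*-monoˡ-<-pos Nℚ q<1)))
    (λ (0≤z , z<N) →
      ℚ.*-cancelʳ-≤-pos Nℚ (subst₂ ℚ._≤_ (sym (ℚ.*-zeroˡ Nℚ)) z≡qN (toℚ-mono-≤ 0≤z)) ,
      ℚ.*-cancelʳ-<-nonNeg Nℚ (subst₂ ℚ._<_ z≡qN (trans toℚN (sym (ℚ.*-identityˡ Nℚ))) (toℚ-mono-< z<N)))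

  InΠ⇔ : ∀ w → InΠ lam w ⇔ (0≤ scaledLast w < N × ∀ t → 0≤ scaledCoord w t < N)
  InΠ⇔ w = mk⇔ to from
    where
    to : InΠ lam w → 0≤ scaledLast w < N × ∀ t → 0≤ scaledCoord w t < N
    to (γ , g , γ-range , g-range , w₀≡ , wₜ≡) =
      Equivalence.to (scaled-range⇔ _ g last≡) g-range ,
      λ t → Equivalence.to (scaled-range⇔ _ (γ t) (scaledCoord-≡ w γ g last≡ t (wₜ≡ t))) (γ-range t)
      where last≡ = scaledLast-≡ w γ g w₀≡ wₜ≡

    from : 0≤ scaledLast w < N × (∀ t → 0≤ scaledCoord w t < N) → InΠ lam w
    from (last-range , coord-range) =
      γ , g , (λ t → Equivalence.from (scaled-range⇔ _ (γ t) (coord≡ t)) (coord-range t)) ,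
      Equivalence.from (scaled-range⇔ _ g last≡) last-range , w₀≡ , wₜ≡
      where
      open ≡-Reasoning
      open +-*-Solver
      g : ℚ
      g = scaledLast w ÷ suc m
      γ : Fin d → ℚ
      γ t = toℚ (w (suc t)) ℚ.- g ℚ.* toℚ (+ lam t)
      last≡ : toℚ (scaledLast w) ≡ g ℚ.* Nℚ
      last≡ = sym (trans (cong (g ℚ.*_) (sym toℚN)) (÷-*-cancel (scaledLast w) m))
      wₜ≡ : ∀ t → toℚ (w (suc t)) ≡ γ t ℚ.+ g ℚ.* toℚ (+ lam t)
      wₜ≡ t = solve 3 (λ x g l → x := (x :- g :* l) :+ g :* l) refl (toℚ (w (suc t))) g (toℚ (+ lam t))
      coord≡ : ∀ t → toℚ (scaledCoord w t) ≡ γ t ℚ.* Nℚ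
      coord≡ t = scaledCoord-≡ w γ g last≡ t (wₜ≡ t)
      w₀≡ : toℚ (w zero) ≡ sumℚ γ ℚ.+ g
      w₀≡ = begin
        toℚ (w zero)                                    ≡⟨ cong toℚ (w₀-as-difference (w zero) (sumℤ (w ∘ suc))) ⟩
        toℚ (sumℤ (w ∘ suc) - scaledLast w)             ≡⟨ toℚ-homo-sub (sumℤ (w ∘ suc)) (scaledLast w) ⟩
        toℚ (sumℤ (w ∘ suc)) ℚ.- toℚ (scaledLast w)      ≡⟨ cong₂ ℚ._-_ (toℚ-sumℤ (w ∘ suc)) last≡ ⟩
        sumℚ (toℚ ∘ w ∘ suc) ℚ.- g ℚ.* Nℚ               ≡⟨ cong (ℚ._- g ℚ.* Nℚ) (trans (sumℚ-cong wₜ≡) (sumℚ-+-* γ _ g)) ⟩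
        (sumℚ γ ℚ.+ g ℚ.* sumℚ (λ t → toℚ (+ lam t))) ℚ.- g ℚ.* Nℚ
                                                       ≡⟨ cong (λ s → (sumℚ γ ℚ.+ g ℚ.* s) ℚ.- g ℚ.* Nℚ) sum-lam ⟩
        (sumℚ γ ℚ.+ g ℚ.* (Nℚ ℚ.+ 1ℚ)) ℚ.- g ℚ.* Nℚ      ≡⟨ solve 3 (λ a g n → (a :+ g :* (n :+ con 1ℚ)) :- g :* n := a :+ g) refl (sumℚ γ) g Nℚ ⟩
        sumℚ γ ℚ.+ g                                    ∎
        where
        w₀-as-difference : ∀ w₀ s → w₀ ≡ s - (s - w₀)
        w₀-as-difference = solve-∀

ceilGap : ℕ → ℕ → ℕ → ℤ
ceilGap m L b = ceiling ((+ (b * L)) ÷ suc m) *ℤ + suc m - + (b * L)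

ceilGap-range : ∀ m L b → 0≤ ceilGap m L b < + suc m
ceilGap-range m L b = ceiling-remainder (+ (b * L)) m

ceilGap-≡ : ∀ m L b K ρ → + (b * L) ≡ + suc m *ℤ K +ℤ ρ → + 0 ℤ.< ρ → ρ ℤ.≤ + suc m →
  ceilGap m L b ≡ + suc m - ρ
ceilGap-≡ m L b K ρ bL≡ 0<ρ ρ≤N = residue-unique (C - K - + 1) (ceilGap-range m L b) N-ρ-range
  (trans (cong (C *ℤ N -_) bL≡) (regroup C N K ρ))
  where
  N = + suc m
  C = ceiling ((+ (b * L)) ÷ suc m)
  N-ρ-range : 0≤ N - ρ < N
  N-ρ-range = ℤ.i≤j⇒0≤j-i ρ≤N ,
    ℤ.<-≤-trans (ℤ.+-monoʳ-< N (ℤ.neg-mono-< 0<ρ)) (ℤ.≤-reflexive (ℤ.+-identityʳ N))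
  regroup : ∀ C N K ρ → C *ℤ N - (N *ℤ K +ℤ ρ) ≡ (N - ρ) +ℤ N *ℤ (C - K - + 1)
  regroup = solve-∀

⪯⇔ : ∀ {d} (lam : Fin d → ℕ) m → sumℕ lam ∸ 1 ≡ suc m → ∀ i j →
  (i ⪯[ lam ] j) ⇔ (0≤ + j - + i < + suc m × ∀ t → ceilGap m (lam t) i ℤ.≤ ceilGap m (lam t) j)
⪯⇔ {d} lam m n∸1≡1+m i j = Fn.trans (InΠ⇔ w) (mk⇔
  (λ (last , coord) → subst (0≤_< N) last≡ last , λ t → Equivalence.to (coord⇔ t) (coord t))
  (λ (last , coord) → subst (0≤_< N) (sym last≡) last , λ t → Equivalence.from (coord⇔ t) (coord t)))
  where
  open Parallelepiped lam m n∸1≡1+m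
  open ≡-Reasoning
  w : Fin (suc d) → ℤ
  w s = pt lam j s - pt lam i s
  ceil : ℕ → Fin d → ℤ
  ceil b t = ceiling ((+ (b * lam t)) ÷ suc m)
  cb≡ceil : ∀ b t → cb lam b t ≡ ceil b t
  cb≡ceil b t = cong (λ k → ceiling ((+ (b * lam t)) ÷ k)) n∸1≡1+m
  last≡ : scaledLast w ≡ + j - + i
  last≡ = trans (cong (_- w zero) (sumℤ-sub (cb lam j) (cb lam i)))
    (cancel (sumℤ (cb lam j)) (sumℤ (cb lam i)) (+ j) (+ i))
    where
    cancel : ∀ Sj Si J I → (Sj - Si) - ((Sj - J) - (Si - I)) ≡ J - I
    cancel = solve-∀
  coord≡ : ∀ t → scaledCoord w t ≡ ceilGap m (lam t) j - ceilGap m (lam t) i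
  coord≡ t = begin
    N *ℤ (cb lam j t - cb lam i t) - scaledLast w *ℤ + lam t
      ≡⟨ cong₂ (λ c s → N *ℤ c - s *ℤ + lam t) (cong₂ _-_ (cb≡ceil j t) (cb≡ceil i t)) last≡ ⟩
    N *ℤ (ceil j t - ceil i t) - (+ j - + i) *ℤ + lam t
      ≡⟨ regroup N (ceil j t) (ceil i t) (+ j) (+ i) (+ lam t) ⟩
    (ceil j t *ℤ N - + j *ℤ + lam t) - (ceil i t *ℤ N - + i *ℤ + lam t)
      ≡⟨ cong₂ (λ J I → (ceil j t *ℤ N - J) - (ceil i t *ℤ N - I)) (ℤ.pos-* j (lam t)) (ℤ.pos-* i (lam t)) ⟨
    ceilGap m (lam t) j - ceilGap m (lam t) i ∎
    where
    regroup : ∀ N Cj Ci J I L → N *ℤ (Cj - Ci) - (J - I) *ℤ L ≡ (Cj *ℤ N - J *ℤ L) - (Ci *ℤ N - I *ℤ L)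
    regroup = solve-∀
  coord⇔ : ∀ t → 0≤ scaledCoord w t < N ⇔ ceilGap m (lam t) i ℤ.≤ ceilGap m (lam t) j
  coord⇔ t = subst (λ z → 0≤ z < N ⇔ _) (sym (coord≡ t))
    (residue-≤⇔ (ceilGap-range m (lam t) i) (ceilGap-range m (lam t) j))

-- Digits

positive-digits : ∀ M x ⦃ _ : ℕ.NonZero x ⦄ r s → 1 ≤ M * r + s → 1 ≤ r + s * x
positive-digits M x (suc r) s _ = s≤s z≤n
positive-digits M (suc x) zero (suc s) _ = s≤s z≤n
positive-digits M x zero zero 0<M*0+0 with trans (ℕ.+-identityʳ (M * 0)) (ℕ.*-zeroʳ M)
... | M*0+0≡0 = ⊥-elim (ℕ.<-irrefl (sym M*0+0≡0) 0<M*0+0)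

*-digits : ∀ M x P r s → x * M ≡ suc P → (M * r + s) * x ≡ P * r + (r + s * x)
*-digits M x P r s xM≡1+P = begin
  (M * r + s) * x        ≡⟨ distribute M x r s ⟩
  (x * M) * r + s * x    ≡⟨ cong (λ z → z * r + s * x) xM≡1+P ⟩
  suc P * r + s * x      ≡⟨ regroup P r s x ⟩
  P * r + (r + s * x)    ∎
  where
  open ≡-Reasoning
  distribute : ∀ M x r s → (M * r + s) * x ≡ (x * M) * r + s * x
  distribute = solve-∀ℕ
  regroup : ∀ P r s x → suc P * r + s * x ≡ P * r + (r + s * x)
  regroup = solve-∀ℕ

swapped-digits-< : ∀ M x {r s} → r < x → s < M → r + s * x < M * x
swapped-digits-< M x {r} {s} r<x s<M = begin-strict
  r + s * x    <⟨ ℕ.+-monoˡ-< (s * x) r<x ⟩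
  suc s * x    ≤⟨ ℕ.*-monoˡ-≤ x s<M ⟩
  M * x        ∎
  where open ℕ.≤-Reasoning

lex-< : ∀ M {r s r' s'} → s < M → r < r' → M * r + s < M * r' + s'
lex-< M {r} {s} {r'} {s'} s<M r<r' = begin-strict
  M * r + s         <⟨ ℕ.+-monoʳ-< (M * r) s<M ⟩
  M * r + M         ≡⟨ trans (ℕ.+-comm (M * r) M) (sym (ℕ.*-suc M r)) ⟩
  M * suc r         ≤⟨ ℕ.*-monoʳ-≤ M r<r' ⟩
  M * r'            ≤⟨ ℕ.m≤m+n (M * r') s' ⟩
  M * r' + s'       ∎
  where open ℕ.≤-Reasoning

lex<∧swapped≤⇔ : ∀ M x ⦃ _ : ℕ.NonZero x ⦄ {r s r' s'} → s < M → s' < M → r' < x →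
  (M * r + s < M * r' + s' × r' + s' * x ≤ r + s * x) ⇔ (r < r' × s' < s)
lex<∧swapped≤⇔ M x {r} {s} {r'} {s'} s<M s'<M r'<x = mk⇔ to from
  where
  open ℕ.≤-Reasoning
  to : M * r + s < M * r' + s' × r' + s' * x ≤ r + s * x → r < r' × s' < s
  to (lt , le) = r<r' , s'<s r<r'
    where
    s'<s : r < r' → s' < s
    s'<s r<r' = ℕ.*-cancelʳ-< x s' s (ℕ.+-cancelˡ-< r (s' * x) (s * x) (begin-strict
      r + s' * x     <⟨ ℕ.+-monoˡ-< (s' * x) r<r' ⟩
      r' + s' * x    ≤⟨ le ⟩
      r + s * x      ∎))
    r<r' : r < r'
    r<r' with ℕ.<-cmp r r'
    ... | tri< r<r' _ _ = r<r'
    ... | tri≈ _ refl _ = ⊥-elim (ℕ.<⇒≱ (ℕ.+-cancelˡ-< (M * r) s s' lt)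
                                    (ℕ.*-cancelʳ-≤ s' s x (ℕ.+-cancelˡ-≤ r (s' * x) (s * x) le)))
    ... | tri> _ _ r'<r = ⊥-elim (ℕ.<-asym lt (lex-< M s'<M r'<r))
  from : r < r' × s' < s → M * r + s < M * r' + s' × r' + s' * x ≤ r + s * x
  from (r<r' , s'<s) = lex-< M s<M r<r' , (begin
    r' + s' * x    ≤⟨ ℕ.+-monoˡ-≤ (s' * x) (ℕ.<⇒≤ r'<x) ⟩
    suc s' * x     ≤⟨ ℕ.*-monoˡ-≤ x s'<s ⟩
    s * x          ≤⟨ ℕ.m≤n+m (s * x) r ⟩
    r + s * x      ∎)

+-divides : ∀ {n N} K → + n ≡ + N *ℤ K → N ∣ n
+-divides {n} {N} K n≡NK = divides ℤ.∣ K ∣ (begin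
  n                  ≡⟨ cong ℤ.∣_∣ n≡NK ⟩
  ℤ.∣ + N *ℤ K ∣     ≡⟨ ℤ.abs-* (+ N) K ⟩
  N * ℤ.∣ K ∣        ≡⟨ ℕ.*-comm N ℤ.∣ K ∣ ⟩
  ℤ.∣ K ∣ * N        ∎)
  where open ≡-Reasoning

∤-*-coprime : ∀ {N a x d} → Coprime N x → Coprime N a → 1 ≤ d → d < N → ¬ N ∣ d * (a * x)
∤-*-coprime {N} {a} {x} {d} N⊥x N⊥a 0<d d<N N∣dax = ℕ.<⇒≱ d<N (ℕ.∣⇒≤ ⦃ ℕ.>-nonZero 0<d ⦄ N∣d)
  where
  N∣axd : N ∣ a * (x * d)
  N∣axd = subst (N ∣_) (rearrange d a x) N∣dax
    where
    rearrange : ∀ d a x → d * (a * x) ≡ a * (x * d)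
    rearrange = solve-∀ℕ
  N∣d : N ∣ d
  N∣d = Coprimality.coprime-divisor N⊥x (Coprimality.coprime-divisor N⊥a N∣axd)

-- The partition λ

sumℕ-const : ∀ L y → sumℕ {L} (λ _ → y) ≡ L * y
sumℕ-const zero y = refl
sumℕ-const (suc L) y = cong (y ℕ.+_) (sumℕ-const L y)

sumℕ-split : ∀ K L y z → sumℕ {K + L} (λ t → if toℕ t <ᵇ K then y else z) ≡ K * y + L * z
sumℕ-split zero L y z = sumℕ-const L z
sumℕ-split (suc K) L y z = trans (cong (y ℕ.+_) (sumℕ-split K L y z)) (sym (ℕ.+-assoc y (K * y) (L * z)))

sum-lamT : ∀ a x u V → u ≤ V → sumℕ (lamT a x u (suc V)) ≡ x * suc ((a + 1) * V)
sum-lamT a x u V u≤V = begin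
  sumℕ (lamT a x u (suc V))                             ≡⟨ sumℕ-split (u * a + suc V) _ x (a * x) ⟩
  (u * a + suc V) * x + (suc V ∸ (u + 1)) * (a * x)     ≡⟨ cong (λ k → (u * a + suc V) * x + (suc V ∸ k) * (a * x)) (ℕ.+-comm u 1) ⟩
  (u * a + suc V) * x + (V ∸ u) * (a * x)               ≡⟨ identity (V ∸ u) V (ℕ.m+[n∸m]≡n u≤V) ⟩
  x * suc ((a + 1) * V)                                 ∎
  where
  open ≡-Reasoning
  identity : ∀ L V → u + L ≡ V → (u * a + suc V) * x + L * (a * x) ≡ x * suc ((a + 1) * V)
  identity L .(u + L) refl = ring a x u L
    where
    ring : ∀ a x u L → (u * a + suc (u + L)) * x + L * (a * x) ≡ x * suc ((a + 1) * (u + L))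
    ring = solve-∀ℕ

lamT-below : ∀ a x u v t → toℕ t < u * a + v → lamT a x u v t ≡ x
lamT-below a x u v t t<K with toℕ t <ᵇ (u * a + v) | ℕ.<⇒<ᵇ t<K
... | true | _ = refl

lamT-above : ∀ a x u v t → u * a + v ≤ toℕ t → lamT a x u v t ≡ a * x
lamT-above a x u v t K≤t with toℕ t <ᵇ (u * a + v) in t<ᵇK
... | false = refl
... | true = ⊥-elim (ℕ.<⇒≱ (ℕ.<ᵇ⇒< (toℕ t) _ (subst Bool.T (sym t<ᵇK) tt)) K≤t)

lamT-values : ∀ a x u v t → lamT a x u v t ≡ x ⊎ lamT a x u v t ≡ a * x
lamT-values a x u v t with toℕ t ℕ.<? u * a + v
... | yes t<K = inj₁ (lamT-below a x u v t t<K)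
... | no t≮K = inj₂ (lamT-above a x u v t (ℕ.≮⇒≥ t≮K))

lamT-attains-x : ∀ a x u v → 1 ≤ u * a + v → Σ (Fin (dim a u v)) λ t → lamT a x u v t ≡ x
lamT-attains-x a x u v 0<K = fromℕ< 0<dim , lamT-below a x u v _ (subst (_< u * a + v) (sym (toℕ-fromℕ< 0<dim)) 0<K)
  where 0<dim = ℕ.<-≤-trans 0<K (ℕ.m≤m+n (u * a + v) (v ∸ (u + 1)))

lamT-attains-ax : ∀ a x u v → 1 ≤ v ∸ (u + 1) → Σ (Fin (dim a u v)) λ t → lamT a x u v t ≡ a * x
lamT-attains-ax a x u v 0<L = fromℕ< K<dim , lamT-above a x u v _ (ℕ.≤-reflexive (sym (toℕ-fromℕ< K<dim)))
  where K<dim = subst (_≤ dim a u v) (ℕ.+-comm (u * a + v) 1) (ℕ.+-monoʳ-≤ (u * a + v) 0<L)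

∀-two-values⇔ : ∀ {d} (f : Fin d → ℕ) {y z} (P : ℕ → Set) → (∀ t → f t ≡ y ⊎ f t ≡ z) →
  Σ (Fin d) (λ t → f t ≡ y) → Σ (Fin d) (λ t → f t ≡ z) → (∀ t → P (f t)) ⇔ (P y × P z)
∀-two-values⇔ f P values (t , ft≡y) (t' , ft'≡z) = mk⇔
  (λ all → subst P ft≡y (all t) , subst P ft'≡z (all t'))
  (λ (Py , Pz) t → [ (λ e → subst P (sym e) Py) , (λ e → subst P (sym e) Pz) ]′ (values t))

*ax-digits : ∀ a x V m r p q → x * suc ((a + 1) * V) ≡ suc (suc m) →
  + ((suc ((a + 1) * V) * r + (V * p + q)) * (a * x)) ≡ + suc m *ℤ (+ a *ℤ + r +ℤ + p) +ℤ fval a x (suc V) r p q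
*ax-digits a x V m r p q xM≡2+m = begin
  + ((M * r + (V * p + q)) * (a * x))
    ≡⟨ ℤ.pos-* (M * r + (V * p + q)) (a * x) ⟩
  + (M * r + (V * p + q)) *ℤ + (a * x)
    ≡⟨ cong₂ _*ℤ_ (cong₂ _+ℤ_ (ℤ.pos-* M r) (cong (_+ℤ + q) (ℤ.pos-* V p))) (ℤ.pos-* a x) ⟩
  (+ M *ℤ + r +ℤ (+ V *ℤ + p +ℤ + q)) *ℤ (+ a *ℤ + x)
    ≡⟨ identity (+ a) (+ x) (+ V) (+ r) (+ p) (+ q) M≡ N≡ xv≡ ⟩
  + suc m *ℤ (+ a *ℤ + r +ℤ + p) +ℤ fval a x (suc V) r p q ∎
  where
  open ≡-Reasoning
  M = suc ((a + 1) * V)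
  M≡ : + M ≡ + 1 +ℤ (+ a +ℤ + 1) *ℤ + V
  M≡ = cong (+ 1 +ℤ_) (ℤ.pos-* (a + 1) V)
  N≡ : + suc m ≡ + x *ℤ + M - + 1
  N≡ = cong (_- + 1) (trans (sym (cong +_ xM≡2+m)) (ℤ.pos-* x M))
  xv≡ : + (x * suc V) ≡ + x *ℤ (+ 1 +ℤ + V)
  xv≡ = ℤ.pos-* x (suc V)
  identity : ∀ A X V r p q {M N XV} → M ≡ + 1 +ℤ (A +ℤ + 1) *ℤ V → N ≡ X *ℤ M - + 1 → XV ≡ X *ℤ (+ 1 +ℤ V) →
    (M *ℤ r +ℤ (V *ℤ p +ℤ q)) *ℤ (A *ℤ X) ≡ N *ℤ (A *ℤ r +ℤ p) +ℤ (A *ℤ r - (XV - + 1) *ℤ p +ℤ X *ℤ A *ℤ q)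
  identity A X V r p q refl refl refl = ring A X V r p q
    where
    ring : ∀ A X V r p q → let M = + 1 +ℤ (A +ℤ + 1) *ℤ V in
      (M *ℤ r +ℤ (V *ℤ p +ℤ q)) *ℤ (A *ℤ X) ≡
      (X *ℤ M - + 1) *ℤ (A *ℤ r +ℤ p) +ℤ (A *ℤ r - (X *ℤ (+ 1 +ℤ V) - + 1) *ℤ p +ℤ X *ℤ A *ℤ q)
    ring = solve-∀

/'≡/ : ∀ n x ⦃ _ : ℕ.NonZero x ⦄ → n /' x ≡ n ℕ./ x
/'≡/ n (suc x) = refl

module Family (a x u V : ℕ) ⦃ _ : ℕ.NonZero x ⦄ (u<V : u < V)
  (n∸1⊥x : Coprime (sumℕ (lamT a x u (suc V)) ∸ 1) x)
  (n∸1⊥a : Coprime (sumℕ (lamT a x u (suc V)) ∸ 1) a) where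

  v : ℕ
  v = suc V

  lam : Fin (dim a u v) → ℕ
  lam = lamT a x u v

  n : ℕ
  n = sumℕ lam

  M : ℕ
  M = suc ((a + 1) * V)

  n≡xM : n ≡ x * M
  n≡xM = sum-lamT a x u V (ℕ.<⇒≤ u<V)

  m : ℕ
  m = x * M ∸ 2

  xM≡2+m : x * M ≡ suc (suc m)
  xM≡2+m = sym (trans (ℕ.+-comm 2 m) (ℕ.m∸n+n≡m 2≤xM))
    where
    2≤M : 2 ≤ M
    2≤M = s≤s (ℕ.*-mono-≤ (ℕ.m≤n+m 1 a) (ℕ.≤-<-trans z≤n u<V))
    2≤xM : 2 ≤ x * M
    2≤xM = ℕ.≤-trans 2≤M (ℕ.m≤n*m M x)

  n∸1≡1+m : n ∸ 1 ≡ suc m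
  n∸1≡1+m = cong (_∸ 1) (trans n≡xM xM≡2+m)

  n/x≡M : n /' x ≡ M
  n/x≡M = trans (cong (_/' x) n≡xM) (trans (/'≡/ (x * M) x) (trans (cong (ℕ._/ x) (ℕ.*-comm x M)) (ℕ.m*n/n≡m M x)))

  N : ℤ
  N = + suc m

  N⊥x : Coprime (suc m) x
  N⊥x = subst (λ k → Coprime k x) n∸1≡1+m n∸1⊥x

  N⊥a : Coprime (suc m) a
  N⊥a = subst (λ k → Coprime k a) n∸1≡1+m n∸1⊥a

  lam-attains-x : Σ (Fin (dim a u v)) λ t → lam t ≡ x
  lam-attains-x = lamT-attains-x a x u v (ℕ.≤-trans (s≤s z≤n) (ℕ.m≤n+m v (u * a)))

  lam-attains-ax : Σ (Fin (dim a u v)) λ t → lam t ≡ a * x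
  lam-attains-ax = lamT-attains-ax a x u v (ℕ.m<n⇒0<n∸m (s≤s (subst (_≤ V) (ℕ.+-comm 1 u) u<V)))

  module Element (k : ℤ) (b r p q : ℕ) (decomp : Decomp a x v n b r p q) (b∈F : InF n k b (fval a x v r p q)) where

    s : ℕ
    s = V * p + q

    b≡Mr+s : b ≡ M * r + s
    b≡Mr+s = trans (proj₁ decomp) (trans (cong (λ z → z * r + V * p + q) n/x≡M) (ℕ.+-assoc (M * r) (V * p) q))

    r<x : r < x
    r<x = proj₁ (proj₂ decomp)

    s<M : s < M
    s<M = subst (s <_) n/x≡M (proj₁ (proj₂ (proj₂ (proj₂ (proj₂ decomp)))))

    0<b : 1 ≤ b
    0<b = proj₁ b∈F

    b≤m : b ≤ m
    b≤m = subst (b ≤_) (cong (_∸ 2) (trans n≡xM xM≡2+m)) (proj₁ (proj₂ b∈F))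

    T : ℕ
    T = r + s * x

    f : ℤ
    f = fval a x v r p q

    F : ℤ
    F = floor (f ÷ suc m)

    ρ : ℤ
    ρ = f - F *ℤ N

    k≡-F : k ≡ ℤ.- F
    k≡-F = trans (proj₂ (proj₂ b∈F)) (cong (λ z → ℤ.- floor (f ÷ z)) n∸1≡1+m)

    ceilGap-x : ceilGap m x b ≡ N - + T
    ceilGap-x = ceilGap-≡ m x b (+ r) (+ T) bx≡ (ℤ.+<+ 0<T) (ℤ.+≤+ T≤N)
      where
      0<T : 1 ≤ T
      0<T = positive-digits M x r s (subst (1 ≤_) b≡Mr+s 0<b)
      T≤N : T ≤ suc m
      T≤N = ℕ.≤-pred (subst (T <_) (trans (ℕ.*-comm M x) xM≡2+m) (swapped-digits-< M x r<x s<M))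
      bx≡ : + (b * x) ≡ N *ℤ + r +ℤ + T
      bx≡ = begin
        + (b * x)                   ≡⟨ cong (λ z → + (z * x)) b≡Mr+s ⟩
        + ((M * r + s) * x)         ≡⟨ cong +_ (*-digits M x (suc m) r s xM≡2+m) ⟩
        + (suc m * r + T)           ≡⟨ cong (_+ℤ + T) (ℤ.pos-* (suc m) r) ⟩
        N *ℤ + r +ℤ + T             ∎
        where open ≡-Reasoning

    K : ℤ
    K = + a *ℤ + r +ℤ + p +ℤ F

    bax≡NK+ρ : + (b * (a * x)) ≡ N *ℤ K +ℤ ρ
    bax≡NK+ρ = begin
      + (b * (a * x))                    ≡⟨ cong (λ z → + (z * (a * x))) b≡Mr+s ⟩
      + ((M * r + s) * (a * x))          ≡⟨ *ax-digits a x V m r p q xM≡2+m ⟩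
      N *ℤ (+ a *ℤ + r +ℤ + p) +ℤ f      ≡⟨ shift N (+ a *ℤ + r +ℤ + p) F f ⟩
      N *ℤ K +ℤ ρ                        ∎
      where
      open ≡-Reasoning
      shift : ∀ N A F f → N *ℤ A +ℤ f ≡ N *ℤ (A +ℤ F) +ℤ (f - F *ℤ N)
      shift = solve-∀

    ρ-range : 0≤ ρ < N
    ρ-range = floor-remainder f m

    0<ρ : + 0 ℤ.< ρ
    0<ρ = ℤ.≤∧≢⇒< (proj₁ ρ-range) λ 0≡ρ →
      ∤-*-coprime N⊥x N⊥a 0<b (s≤s b≤m)
        (+-divides K (trans bax≡NK+ρ (trans (cong (N *ℤ K +ℤ_) (sym 0≡ρ)) (ℤ.+-identityʳ (N *ℤ K)))))

    ceilGap-ax : ceilGap m (a * x) b ≡ N - ρ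
    ceilGap-ax = ceilGap-≡ m (a * x) b K ρ bax≡NK+ρ 0<ρ (ℤ.<⇒≤ (proj₂ ρ-range))

  module Pair (k ℓ : ℤ) (i j rᵢ pᵢ qᵢ rⱼ pⱼ qⱼ : ℕ)
    (decompᵢ : Decomp a x v n i rᵢ pᵢ qᵢ) (decompⱼ : Decomp a x v n j rⱼ pⱼ qⱼ)
    (i∈F : InF n k i (fval a x v rᵢ pᵢ qᵢ)) (j∈F : InF n (k +ℤ ℓ) j (fval a x v rⱼ pⱼ qⱼ)) where

    module I = Element k i rᵢ pᵢ qᵢ decompᵢ i∈F
    module J = Element (k +ℤ ℓ) j rⱼ pⱼ qⱼ decompⱼ j∈F

    Digits : Set
    Digits = rᵢ < rⱼ × J.s < I.s × J.ρ ℤ.< I.ρ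

    ρ-injective : i < j → I.ρ ≢ J.ρ
    ρ-injective i<j ρᵢ≡ρⱼ = ∤-*-coprime N⊥x N⊥a (ℕ.m<n⇒0<n∸m i<j) j∸i<N (+-divides (J.K - I.K) [j∸i]ax≡NK)
      where
      j∸i<N : j ∸ i < suc m
      j∸i<N = s≤s (ℕ.≤-trans (ℕ.m∸n≤m j i) J.b≤m)
      split : + (i * (a * x)) +ℤ + ((j ∸ i) * (a * x)) ≡ + (j * (a * x))
      split = cong +_ (trans (sym (ℕ.*-distribʳ-+ (a * x) i (j ∸ i))) (cong (_* (a * x)) (ℕ.m+[n∸m]≡n (ℕ.<⇒≤ i<j))))
      residue-difference : ∀ {B D Kᵢ Kⱼ ρ} → B ≡ N *ℤ Kᵢ +ℤ ρ → B +ℤ D ≡ N *ℤ Kⱼ +ℤ ρ → D ≡ N *ℤ (Kⱼ - Kᵢ)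
      residue-difference {D = D} {Kᵢ} {Kⱼ} {ρ} refl B+D≡ =
        trans (isolate D N Kᵢ ρ) (trans (cong (_- (N *ℤ Kᵢ +ℤ ρ)) B+D≡) (factor N Kᵢ Kⱼ ρ))
        where
        isolate : ∀ D N Kᵢ ρ → D ≡ ((N *ℤ Kᵢ +ℤ ρ) +ℤ D) - (N *ℤ Kᵢ +ℤ ρ)
        isolate = solve-∀
        factor : ∀ N Kᵢ Kⱼ ρ → (N *ℤ Kⱼ +ℤ ρ) - (N *ℤ Kᵢ +ℤ ρ) ≡ N *ℤ (Kⱼ - Kᵢ)
        factor = solve-∀
      [j∸i]ax≡NK : + ((j ∸ i) * (a * x)) ≡ N *ℤ (J.K - I.K)
      [j∸i]ax≡NK = residue-difference {Kᵢ = I.K} {J.K} I.bax≡NK+ρ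
        (trans split (trans J.bax≡NK+ρ (cong (N *ℤ J.K +ℤ_) (sym ρᵢ≡ρⱼ))))

    ⪯⇔range×gaps : (i ⪯[ lam ] j) ⇔ (0≤ + j - + i < N × J.T ≤ I.T × J.ρ ℤ.≤ I.ρ)
    ⪯⇔range×gaps = Fn.trans (⪯⇔ lam m n∸1≡1+m i j) (Fn.refl ×-⇔ Fn.trans
      (∀-two-values⇔ lam Gap≤ (lamT-values a x u v) lam-attains-x lam-attains-ax) (x-gaps ×-⇔ ax-gaps))
      where
      Gap≤ : ℕ → Set
      Gap≤ L = ceilGap m L i ℤ.≤ ceilGap m L j
      x-gaps : Gap≤ x ⇔ J.T ≤ I.T
      x-gaps = subst₂ (λ A B → (A ℤ.≤ B) ⇔ J.T ≤ I.T) (sym I.ceilGap-x) (sym J.ceilGap-x)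
        (Fn.trans (-≤-⇔≥ N (+ I.T) (+ J.T)) (mk⇔ ℤ.drop‿+≤+ ℤ.+≤+))
      ax-gaps : Gap≤ (a * x) ⇔ J.ρ ℤ.≤ I.ρ
      ax-gaps = subst₂ (λ A B → (A ℤ.≤ B) ⇔ J.ρ ℤ.≤ I.ρ) (sym I.ceilGap-ax) (sym J.ceilGap-ax) (-≤-⇔≥ N I.ρ J.ρ)

    lex⇔ : (i < j × J.T ≤ I.T) ⇔ (rᵢ < rⱼ × J.s < I.s)
    lex⇔ = subst₂ (λ i' j' → (i' < j' × J.T ≤ I.T) ⇔ (rᵢ < rⱼ × J.s < I.s)) (sym I.b≡Mr+s) (sym J.b≡Mr+s)
      (lex<∧swapped≤⇔ M x I.s<M J.s<M J.r<x)

    range⇔< : i ≢ j → (0≤ + j - + i < N) ⇔ (i < j)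
    range⇔< i≢j = mk⇔
      (λ (0≤j-i , _) → ℕ.≤∧≢⇒< (ℤ.drop‿+≤+ (ℤ.0≤i-j⇒j≤i 0≤j-i)) i≢j)
      (λ i<j → ℤ.i≤j⇒0≤j-i (ℤ.+≤+ (ℕ.<⇒≤ i<j)) , ℤ.≤-<-trans (ℤ.i-j≤i (+ j) (+ i)) (ℤ.+<+ (s≤s J.b≤m)))

    ⪯⇔Digits : i ≢ j → (i ⪯[ lam ] j) ⇔ Digits
    ⪯⇔Digits i≢j = Fn.trans ⪯⇔range×gaps (mk⇔ to from)
      where
      to : 0≤ + j - + i < N × J.T ≤ I.T × J.ρ ℤ.≤ I.ρ → Digits
      to (range , T≤ , ρ≤) =
        let i<j = Equivalence.to (range⇔< i≢j) range
            (r< , s<) = Equivalence.to lex⇔ (i<j , T≤)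
        in r< , s< , ℤ.≤∧≢⇒< ρ≤ (ρ-injective i<j ∘ sym)
      from : Digits → 0≤ + j - + i < N × J.T ≤ I.T × J.ρ ℤ.≤ I.ρ
      from (r< , s< , ρ<) =
        let (i<j , T≤) = Equivalence.from lex⇔ (r< , s<)
        in Equivalence.from (range⇔< i≢j) i<j , T≤ , ℤ.<⇒≤ ρ<

    y : Fin 3 → ℤ
    y = vec3 (+ pⱼ - + pᵢ) (+ qⱼ - + qᵢ) (+ rⱼ - + rᵢ)

    ℓ≡Fᵢ-Fⱼ : ℓ ≡ I.F - J.F
    ℓ≡Fᵢ-Fⱼ = begin
      ℓ                    ≡⟨ isolate k ℓ ⟩
      (k +ℤ ℓ) - k         ≡⟨ cong₂ _-_ J.k≡-F I.k≡-F ⟩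
      ℤ.- J.F - ℤ.- I.F    ≡⟨ swap J.F I.F ⟩
      I.F - J.F            ∎
      where
      open ≡-Reasoning
      isolate : ∀ k ℓ → ℓ ≡ (k +ℤ ℓ) - k
      isolate = solve-∀
      swap : ∀ Fⱼ Fᵢ → ℤ.- Fⱼ - ℤ.- Fᵢ ≡ Fᵢ - Fⱼ
      swap = solve-∀

    row₀ : (Cmat a x v · y) zero ≡ (I.ρ - J.ρ) +ℤ ℓ *ℤ N
    row₀ = begin
      (Cmat a x v · y) zero                   ≡⟨ row₀≡fᵢ-fⱼ (+ (x * v)) (+ a) (+ x) (ℤ.pos-* a x) ⟩
      I.f - J.f                               ≡⟨ split I.f J.f I.F J.F N ⟩
      (I.ρ - J.ρ) +ℤ (I.F - J.F) *ℤ N         ≡⟨ cong (λ l → (I.ρ - J.ρ) +ℤ l *ℤ N) ℓ≡Fᵢ-Fⱼ ⟨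
      (I.ρ - J.ρ) +ℤ ℓ *ℤ N                   ∎
      where
      open ≡-Reasoning
      row₀≡fᵢ-fⱼ : ∀ XV A X {AX} → AX ≡ A *ℤ X →
        (XV - + 1) *ℤ (+ pⱼ - + pᵢ) +ℤ ((ℤ.- AX) *ℤ (+ qⱼ - + qᵢ) +ℤ ((ℤ.- A) *ℤ (+ rⱼ - + rᵢ) +ℤ + 0)) ≡
        (A *ℤ + rᵢ - (XV - + 1) *ℤ + pᵢ +ℤ X *ℤ A *ℤ + qᵢ) - (A *ℤ + rⱼ - (XV - + 1) *ℤ + pⱼ +ℤ X *ℤ A *ℤ + qⱼ)
      row₀≡fᵢ-fⱼ XV A X refl = ring XV A X (+ rᵢ) (+ pᵢ) (+ qᵢ) (+ rⱼ) (+ pⱼ) (+ qⱼ)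
        where
        ring : ∀ XV A X rᵢ pᵢ qᵢ rⱼ pⱼ qⱼ →
          (XV - + 1) *ℤ (pⱼ - pᵢ) +ℤ ((ℤ.- (A *ℤ X)) *ℤ (qⱼ - qᵢ) +ℤ ((ℤ.- A) *ℤ (rⱼ - rᵢ) +ℤ + 0)) ≡
          (A *ℤ rᵢ - (XV - + 1) *ℤ pᵢ +ℤ X *ℤ A *ℤ qᵢ) - (A *ℤ rⱼ - (XV - + 1) *ℤ pⱼ +ℤ X *ℤ A *ℤ qⱼ)
        ring = solve-∀
      split : ∀ fᵢ fⱼ Fᵢ Fⱼ N → fᵢ - fⱼ ≡ ((fᵢ - Fᵢ *ℤ N) - (fⱼ - Fⱼ *ℤ N)) +ℤ (Fᵢ - Fⱼ) *ℤ N
      split = solve-∀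

    row₁ : (Cmat a x v · y) (suc zero) ≡ + I.s - + J.s
    row₁ = trans (ring (+ V) (+ pᵢ) (+ qᵢ) (+ pⱼ) (+ qⱼ) (+ rⱼ - + rᵢ))
      (cong₂ _-_ (cong (_+ℤ + qᵢ) (sym (ℤ.pos-* V pᵢ))) (cong (_+ℤ + qⱼ) (sym (ℤ.pos-* V pⱼ))))
      where
      ring : ∀ V pᵢ qᵢ pⱼ qⱼ r → (+ 1 - (+ 1 +ℤ V)) *ℤ (pⱼ - pᵢ) +ℤ ((ℤ.- + 1) *ℤ (qⱼ - qᵢ) +ℤ (+ 0 *ℤ r +ℤ + 0))
        ≡ (V *ℤ pᵢ +ℤ qᵢ) - (V *ℤ pⱼ +ℤ qⱼ)
      ring = solve-∀

    row₂ : (Cmat a x v · y) (suc (suc zero)) ≡ + rⱼ - + rᵢ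
    row₂ = ring (+ pⱼ - + pᵢ) (+ qⱼ - + qᵢ) (+ rⱼ - + rᵢ)
      where
      ring : ∀ p q r → + 0 *ℤ p +ℤ (+ 0 *ℤ q +ℤ (+ 1 *ℤ r +ℤ + 0)) ≡ r
      ring = solve-∀

    C⇔Digits : ((Cmat a x v · y) >ᶜ vec3 (ℓ *ℤ + (n ∸ 1)) (+ 0) (+ 0)) ⇔ Digits
    C⇔Digits = mk⇔
      (λ C> → Equivalence.to row₂⇔ (C> (suc (suc zero))) , Equivalence.to row₁⇔ (C> (suc zero)) ,
              Equivalence.to row₀⇔ (C> zero))
      (λ (r< , s< , ρ<) → λ where
        zero → Equivalence.from row₀⇔ ρ<
        (suc zero) → Equivalence.from row₁⇔ s<
        (suc (suc zero)) → Equivalence.from row₂⇔ r<)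
      where
      0<+-+⇔ : ∀ {z A B} → z ≡ + A - + B → (+ 0 ℤ.< z) ⇔ (B < A)
      0<+-+⇔ {A = A} {B} refl = Fn.trans (0<-⇔< (+ B) (+ A)) (mk⇔ ℤ.drop‿+<+ ℤ.+<+)
      row₀⇔ : (ℓ *ℤ + (n ∸ 1) ℤ.< (Cmat a x v · y) zero) ⇔ (J.ρ ℤ.< I.ρ)
      row₀⇔ = subst₂ (λ c z → (ℓ *ℤ c ℤ.< z) ⇔ (J.ρ ℤ.< I.ρ)) (cong +_ (sym n∸1≡1+m)) (sym row₀)
        (Fn.trans (<+⇔0< (ℓ *ℤ N) (I.ρ - J.ρ)) (0<-⇔< J.ρ I.ρ))
      row₁⇔ : (+ 0 ℤ.< (Cmat a x v · y) (suc zero)) ⇔ (J.s < I.s)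
      row₁⇔ = 0<+-+⇔ row₁
      row₂⇔ : (+ 0 ℤ.< (Cmat a x v · y) (suc (suc zero))) ⇔ (rᵢ < rⱼ)
      row₂⇔ = 0<+-+⇔ row₂

  theorem : (k ℓ : ℤ) (i j rᵢ pᵢ qᵢ rⱼ pⱼ qⱼ : ℕ) →
    Decomp a x v n i rᵢ pᵢ qᵢ → Decomp a x v n j rⱼ pⱼ qⱼ →
    InF n k i (fval a x v rᵢ pᵢ qᵢ) → InF n (k +ℤ ℓ) j (fval a x v rⱼ pⱼ qⱼ) → i ≢ j →
    (i ⪯[ lam ] j) ⇔
      ((Cmat a x v · vec3 (+ pⱼ - + pᵢ) (+ qⱼ - + qᵢ) (+ rⱼ - + rᵢ)) >ᶜ vec3 (ℓ *ℤ (+ (n ∸ 1))) (+ 0) (+ 0))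
  theorem k ℓ i j rᵢ pᵢ qᵢ rⱼ pⱼ qⱼ decompᵢ decompⱼ i∈F j∈F i≢j = Fn.trans (⪯⇔Digits i≢j) (Fn.sym C⇔Digits)
    where open Pair k ℓ i j rᵢ pᵢ qᵢ rⱼ pⱼ qⱼ decompᵢ decompⱼ i∈F j∈F

theorem4p7 : (a x u v : ℕ) → 3 ≤ a → a ≤ x → u + 3 ≤ a → u + 2 ≤ v → v + 1 ≤ a → x * v + a ≤ a * x →
    Coprime (sumℕ (lamT a x u v) ∸ 1) x → Coprime (sumℕ (lamT a x u v) ∸ 1) a →
    (k ℓ : ℤ) (i j rᵢ pᵢ qᵢ rⱼ pⱼ qⱼ : ℕ) →
    Decomp a x v (sumℕ (lamT a x u v)) i rᵢ pᵢ qᵢ →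
    Decomp a x v (sumℕ (lamT a x u v)) j rⱼ pⱼ qⱼ →
    InF (sumℕ (lamT a x u v)) k i (fval a x v rᵢ pᵢ qᵢ) →
    InF (sumℕ (lamT a x u v)) (k +ℤ ℓ) j (fval a x v rⱼ pⱼ qⱼ) →
    i ≢ j →
    (i ⪯[ lamT a x u v ] j) ⇔
      ((Cmat a x v · vec3 (+ pⱼ - + pᵢ) (+ qⱼ - + qᵢ) (+ rⱼ - + rᵢ))
        >ᶜ vec3 (ℓ *ℤ (+ (sumℕ (lamT a x u v) ∸ 1))) (+ 0) (+ 0))
theorem4p7 a x u zero _ _ _ u+2≤0 with () ← ℕ.m+n≤o⇒n≤o u u+2≤0
theorem4p7 a x u (suc V) 3≤a a≤x _ u+2≤v _ _ n∸1⊥x n∸1⊥a =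
  Family.theorem a x u V ⦃ ℕ.>-nonZero (ℕ.≤-trans (s≤s z≤n) (ℕ.≤-trans 3≤a a≤x)) ⦄ u<V n∸1⊥x n∸1⊥a
  where
  u<V : u < V
  u<V = ℕ.≤-pred (subst (_≤ suc V) (ℕ.+-comm u 2) u+2≤v)
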